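{- A unary query $\mathcal Q$ on $\ell$-labelled graphs is computable by a family of 1-GNNs if and only if it is computable by a family of 2-GNNs.
   Context: Graphs are finite, simple, undirected; an $\ell$-labelled graph has unary relations $P_1,\dots,P_\ell$ on its vertices and is identified with the Boolean signal $\mathcal b:V(G)\to\{0,1\}^\ell$, $\mathcal b(v)_i=1\iff v\in P_i(G)$. A unary query maps each $\ell$-labelled graph $G$ to an isomorphism-invariant set $\mathcal Q(G)\subseteq V(G)$. An FNN is a composition of layers $\vec x\mapsto\sigma(A\vec x+\vec b)$ with rational $A,\vec b$ and $\sigma\in\{\mathrm{ReLU},\mathrm{id}\}$ applied coordinatewise. A 1-GNN layer is a triple $(\mathrm{msg},\mathrm{agg},\mathrm{comb})$ with $\mathrm{msg}:\mathbb R^p\to\mathbb R^r$, $\mathrm{comb}:\mathbb R^{p+r}\to\mathbb R^q$ computed by FNNs and $\mathrm{agg}\in\{\mathrm{SUM},\mathrm{MEAN},\mathrm{MAX}\}$ (coordinatewise on finite multisets, $\vec 0$ on the empty multiset), mapping a signal $\mathcal f$ to $\mathcal f'(v)=\mathrm{comb}\big(\mathcal f(v),\mathrm{agg}(\{\!\{\mathrm{msg}(\mathcal f(w)):w\in N_G(v)\}\!\})\big)$; a 2-GNN layer is the same with $\mathrm{msg}:\mathbb R^{2p}\to\mathbb R^r$ and messages $\mathrm{msg}(\mathcal f(v),\mathcal f(w))$. An $i$-GNN is a sequence of $i$-GNN layers with matching dimensions, computing their composition; $S_{\mathfrak N}(G,\mathcal b)$ denotes its output signal. A family $(\mathfrak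 N_n)_{n\in\mathbb N}$ of GNNs with input dimension $\ell$ and output dimension $1$ computes $\mathcal Q$ if for all $n\ge 1$, all $\ell$-labelled graphs $G$ with $|V(G)|=n$ and all $v\in V(G)$: $S_{\mathfrak N_n}(G,\mathcal b)(v)\ge 3/4$ if $v\in\mathcal Q(G)$ and $\le 1/4$ otherwise. -}

module Defs where

open import Data.Nat as ℕ using (ℕ; zero; suc)
open import Data.Integer using (+_)
open import Data.Rational using (ℚ; 0ℚ; 1ℚ; _+_; _*_; _⊔_; _≤_; _/_)
open import Data.Fin using (Fin)
open import Data.Bool using (Bool; true; false; if_then_else_)
open import Data.List using (List; []; _∷_; filterᵇ; length; map)
open import Data.Vec.Functional using (Vector; _++_)
open import Data.Product using (Σ; _×_)
open import Function.Bundles using (_↔_; Inverse)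
open import Relation.Binary.PropositionalEquality using (_≡_)
import Data.List as L

-- Graphs: finite simple undirected graphs on vertex set Fin n,
-- with ℓ unary relations P_1..P_ℓ (labels v i ≡ true  iff  v ∈ P_i).

record LGraph (ℓ n : ℕ) : Set where
  field
    adj    : Fin n → Fin n → Bool
    symm   : ∀ i j → adj i j ≡ adj j i
    irrefl : ∀ i → adj i i ≡ false
    labels : Fin n → Fin ℓ → Bool
open LGraph public

IsIso : ∀ {ℓ n} → LGraph ℓ n → LGraph ℓ n → (Fin n ↔ Fin n) → Set
IsIso G H π =
  (∀ i j → adj H (Inverse.to π i) (Inverse.to π j) ≡ adj G i j) ×
  (∀ i k → labels H (Inverse.to π i) k ≡ labels G i k)

record Query (ℓ : ℕ) : Set₁ where
  field
    Q         : ∀ {n} → LGraph ℓ n → Fin n → Bool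
    invariant : ∀ {n} (G H : LGraph ℓ n) (π : Fin n ↔ Fin n) → IsIso G H π →
                ∀ v → Q H (Inverse.to π v) ≡ Q G v
open Query public

Vecℚ : ℕ → Set
Vecℚ p = Vector ℚ p

sumFin : ∀ {p} → (Fin p → ℚ) → ℚ
sumFin {zero}  f = 0ℚ
sumFin {suc p} f = f Fin.zero + sumFin (λ i → f (Fin.suc i))
  where import Data.Fin as Fin

data Activation : Set where
  relu ident : Activation

activate : Activation → ℚ → ℚ
activate relu  x = 0ℚ ⊔ x
activate ident x = x

record FLayer (p q : ℕ) : Set where
  field
    A   : Fin q → Fin p → ℚ
    b   : Fin q → ℚ
    act : Activation

applyFLayer : ∀ {p q} → FLayer p q → Vecℚ p → Vecℚ q
applyFLayer L x i = activate (FLayer.act L) (sumFin (λ j → FLayer.A L i j * x j) + FLayer.b L i)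

data FNN : ℕ → ℕ → Set where
  done : ∀ {p} → FNN p p
  _∷_  : ∀ {p q r} → FLayer p q → FNN q r → FNN p r

runFNN : ∀ {p q} → FNN p q → Vecℚ p → Vecℚ q
runFNN done     x = x
runFNN (L ∷ N)  x = runFNN N (applyFLayer L x)

-- Aggregation on finite multisets (given as lists), coordinatewise,
-- 0 on the empty multiset.

data AggFn : Set where
  SUM MEAN MAX : AggFn

sumList : List ℚ → ℚ
sumList []       = 0ℚ
sumList (x ∷ xs) = x + sumList xs

maxNE : ℚ → List ℚ → ℚ
maxNE x []       = x
maxNE x (y ∷ ys) = x ⊔ maxNE y ys

maxList : List ℚ → ℚ
maxList []       = 0ℚ
maxList (x ∷ xs) = maxNE x xs

meanList : List ℚ → ℚ
meanList xs with length xs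
... | zero  = 0ℚ
... | suc k = sumList xs * ((+ 1) / suc k)

aggregate : ∀ {r} → AggFn → List (Vecℚ r) → Vecℚ r
aggregate SUM  ms i = sumList  (map (λ m → m i) ms)
aggregate MEAN ms i = meanList (map (λ m → m i) ms)
aggregate MAX  ms i = maxList  (map (λ m → m i) ms)

neighbours : ∀ {ℓ n} → LGraph ℓ n → Fin n → List (Fin n)
neighbours {n = n} G v = filterᵇ (adj G v) (L.allFin n)

record GNN1Layer (p q : ℕ) : Set where
  field
    r    : ℕ
    msg  : FNN p r
    agg  : AggFn
    comb : FNN (p ℕ.+ r) q

record GNN2Layer (p q : ℕ) : Set where
  field
    r    : ℕ
    msg  : FNN (p ℕ.+ p) r
    agg  : AggFn
    comb : FNN (p ℕ.+ r) q

Signal : ℕ → ℕ → Set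
Signal n p = Fin n → Vecℚ p

applyGNN1Layer : ∀ {ℓ n p q} → GNN1Layer p q → LGraph ℓ n → Signal n p → Signal n q
applyGNN1Layer L G f v =
  runFNN (GNN1Layer.comb L)
    (f v ++ aggregate (GNN1Layer.agg L)
                      (map (λ w → runFNN (GNN1Layer.msg L) (f w)) (neighbours G v)))

applyGNN2Layer : ∀ {ℓ n p q} → GNN2Layer p q → LGraph ℓ n → Signal n p → Signal n q
applyGNN2Layer L G f v =
  runFNN (GNN2Layer.comb L)
    (f v ++ aggregate (GNN2Layer.agg L)
                      (map (λ w → runFNN (GNN2Layer.msg L) (f v ++ f w)) (neighbours G v)))

data GNN1 : ℕ → ℕ → Set where
  done : ∀ {p} → GNN1 p p
  _∷_  : ∀ {p q r} → GNN1Layer p q → GNN1 q r → GNN1 p r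

data GNN2 : ℕ → ℕ → Set where
  done : ∀ {p} → GNN2 p p
  _∷_  : ∀ {p q r} → GNN2Layer p q → GNN2 q r → GNN2 p r

runGNN1 : ∀ {ℓ n p q} → GNN1 p q → LGraph ℓ n → Signal n p → Signal n q
runGNN1 done    G f = f
runGNN1 (L ∷ N) G f = runGNN1 N G (applyGNN1Layer L G f)

runGNN2 : ∀ {ℓ n p q} → GNN2 p q → LGraph ℓ n → Signal n p → Signal n q
runGNN2 done    G f = f
runGNN2 (L ∷ N) G f = runGNN2 N G (applyGNN2Layer L G f)

boolSignal : ∀ {ℓ n} → LGraph ℓ n → Signal n ℓ
boolSignal G v i = if labels G v i then 1ℚ else 0ℚ

threeQuarters oneQuarter : ℚ
threeQuarters = (+ 3) / 4
oneQuarter    = (+ 1) / 4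

Computes : ∀ {ℓ} → Query ℓ → (∀ {n} → ℕ → LGraph ℓ n → Fin n → ℚ) → Set
Computes {ℓ} 𝒬 out =
  ∀ (n : ℕ) → 1 ℕ.≤ n → (G : LGraph ℓ n) → (v : Fin n) →
    (Q 𝒬 G v ≡ true  → threeQuarters ≤ out n G v) ×
    (Q 𝒬 G v ≡ false → out n G v ≤ oneQuarter)

ComputedByGNN1Family : ∀ {ℓ} → Query ℓ → Set
ComputedByGNN1Family {ℓ} 𝒬 =
  Σ (ℕ → GNN1 ℓ 1) λ 𝔑 →
    Computes 𝒬 (λ n G v → runGNN1 (𝔑 n) G (boolSignal G) v Fin.zero)
  where import Data.Fin as Fin

ComputedByGNN2Family : ∀ {ℓ} → Query ℓ → Set
ComputedByGNN2Family {ℓ} 𝒬 =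
  Σ (ℕ → GNN2 ℓ 1) λ 𝔑 →
    Computes 𝒬 (λ n G v → runGNN2 (𝔑 n) G (boolSignal G) v Fin.zero)
  where import Data.Fin as Fin

-- A 1-GNN layer is a 2-GNN layer whose message ignores the receiver, so 1-GNN families are
-- 2-GNN families. Conversely, fix the order n of the input graphs. Starting from Boolean labels,
-- the features after every layer range over a finite set S of rational vectors that depends on
-- n alone. A 1-GNN layer can then send, for every candidate receiver feature s ∈ S, the message
-- that the 2-GNN would send to a receiver with feature s; aggregation acts coordinatewise, so
-- the receiver recovers its 2-GNN aggregate by reading the block of its own feature. The table
-- of messages and this block selection are functions on finite sets of vectors, and every such
-- function is computed by a three-layer ReLU network: a sum of hat functions
-- ReLU (1 - K · ∥x - t∥₁), one for each point t.
module Submission where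

open import Defs
open import Data.Bool using (true; false; if_then_else_)
open import Data.Fin using (Fin; zero; suc; _↑ˡ_; _↑ʳ_; combine; remQuot; splitAt)
import Data.Fin.Properties as Fin
open import Data.Fin.Properties using (suc-injective; remQuot-combine; ¬∀⟶∃¬)
open import Data.List
  using (List; []; _∷_; [_]; length; lookup; map; allFin; cartesianProductWith; deduplicate)
open import Data.List.Properties using (map-∘; length-map; length-filter; length-tabulate)
import Data.List.Membership.Propositional.Properties as Propositional
import Data.List.Membership.Setoid as Membership
open import Data.List.Membership.Setoid.Properties
  using (∈-resp-≈; ∈-map⁺; ∈-lookup; ∈-deduplicate⁺; ∈-cartesianProductWith⁺)
import Data.List.Relation.Binary.Equality.Setoid as Equality
open import Data.List.Relation.Binary.Pointwise
  using ([]; _∷_) renaming (Pointwise to ListPointwise)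
import Data.List.Relation.Binary.Pointwise as ListPointwise
open import Data.List.Relation.Unary.All using (All; []; _∷_)
import Data.List.Relation.Unary.All as All
import Data.List.Relation.Unary.All.Properties as All
open import Data.List.Relation.Unary.AllPairs using ([]; _∷_)
open import Data.List.Relation.Unary.Any using (Any; here; there; index; any?)
open import Data.List.Relation.Unary.Any.Properties using (lookup-index)
open import Data.List.Relation.Unary.Unique.DecSetoid.Properties using (deduplicate-!)
import Data.List.Relation.Unary.Unique.Setoid as Unique
open import Data.Nat as ℕ using (ℕ; zero; suc)
import Data.Nat.Properties as ℕ
open import Data.Product using (∃; _×_; _,_; proj₁; proj₂)
open import Data.Rational
  using (ℚ; 0ℚ; 1ℚ; _+_; _*_; -_; _-_; _≤_; _<_; 1/_; ≢-nonZero; nonNegative)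
open import Data.Rational.Properties
open import Data.Sum using (inj₁; inj₂)
open import Data.Vec.Functional using (Vector; _++_; take; drop)
import Data.Vec.Functional as V
open import Data.Vec.Functional.Properties using (++-cong; lookup-++ˡ; lookup-++ʳ)
open import Data.Vec.Functional.Relation.Binary.Pointwise using (Pointwise)
import Data.Vec.Functional.Relation.Binary.Pointwise.Properties as Pointwise
open import Function using (id; _∘_; _⇔_; mk⇔)
open import Level using (0ℓ)
open import Relation.Binary using (Setoid; DecSetoid; _Preserves_⟶_; tri<; tri≈; tri>)
open import Relation.Binary.PropositionalEquality hiding ([_])
open import Relation.Nullary using (Dec; ¬_; yes; no; does; contradiction)
open import Relation.Nullary.Decidable using (dec-true; dec-false; T?)

private
  variable
    p q : ℕ

sumFin-cong : {f g : Fin p → ℚ} → f ≗ g → sumFin f ≡ sumFin g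
sumFin-cong {zero}  e = refl
sumFin-cong {suc p} e = cong₂ _+_ (e zero) (sumFin-cong (e ∘ suc))

sumFin-zero : {f : Fin p → ℚ} → (∀ i → f i ≡ 0ℚ) → sumFin f ≡ 0ℚ
sumFin-zero {zero}  e = refl
sumFin-zero {suc p} e = trans (cong₂ _+_ (e zero) (sumFin-zero (e ∘ suc))) (+-identityˡ 0ℚ)

sumFin-single : (f : Fin p → ℚ) (i : Fin p) →
                (∀ j → j ≢ i → f j ≡ 0ℚ) → sumFin f ≡ f i
sumFin-single f zero    e =
  trans (cong (f zero +_) (sumFin-zero (λ j → e (suc j) λ ()))) (+-identityʳ (f zero))
sumFin-single f (suc i) e = begin
  f zero + sumFin (f ∘ suc) ≡⟨ cong (_+ sumFin (f ∘ suc)) (e zero λ ()) ⟩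
  0ℚ + sumFin (f ∘ suc)     ≡⟨ +-identityˡ _ ⟩
  sumFin (f ∘ suc)          ≡⟨ sumFin-single (f ∘ suc) i e′ ⟩
  f (suc i)                 ∎
  where
  open ≡-Reasoning
  e′ : ∀ j → j ≢ i → f (suc j) ≡ 0ℚ
  e′ j j≢i = e (suc j) (j≢i ∘ suc-injective)

*-distribˡ-sumFin : (a : ℚ) (f : Fin p → ℚ) → a * sumFin f ≡ sumFin (λ i → a * f i)
*-distribˡ-sumFin {zero}  a f = *-zeroʳ a
*-distribˡ-sumFin {suc p} a f =
  trans (*-distribˡ-+ a (f zero) _) (cong (a * f zero +_) (*-distribˡ-sumFin a (f ∘ suc)))

sumFin-split : ∀ m n (f : Fin (m ℕ.+ n) → ℚ) →
               sumFin f ≡ sumFin (f ∘ (_↑ˡ n)) + sumFin (f ∘ (m ↑ʳ_))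
sumFin-split zero    n f = sym (+-identityˡ _)
sumFin-split (suc m) n f =
  trans (cong (f zero +_) (sumFin-split m n (f ∘ suc))) (sym (+-assoc (f zero) _ _))

sumFin-combine : ∀ m n (f : Fin (m ℕ.* n) → ℚ) →
                 sumFin f ≡ sumFin {m} (λ i → sumFin {n} (λ j → f (combine i j)))
sumFin-combine zero    n f = refl
sumFin-combine (suc m) n f =
  trans (sumFin-split n (m ℕ.* n) f)
        (cong (sumFin (f ∘ (_↑ˡ m ℕ.* n)) +_) (sumFin-combine m n (f ∘ (n ↑ʳ_))))

sumFin-nonneg : {f : Fin p → ℚ} → (∀ i → 0ℚ ≤ f i) → 0ℚ ≤ sumFin f
sumFin-nonneg {zero}  f≥0 = ≤-refl
sumFin-nonneg {suc p} f≥0 = +-mono-≤ (f≥0 zero) (sumFin-nonneg (f≥0 ∘ suc))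

term≤sumFin : {f : Fin p → ℚ} → (∀ i → 0ℚ ≤ f i) → ∀ i → f i ≤ sumFin f
term≤sumFin {f = f} f≥0 zero = begin
  f zero                    ≡⟨ sym (+-identityʳ (f zero)) ⟩
  f zero + 0ℚ               ≤⟨ +-monoʳ-≤ (f zero) (sumFin-nonneg (f≥0 ∘ suc)) ⟩
  f zero + sumFin (f ∘ suc) ∎
  where open ≤-Reasoning
term≤sumFin {f = f} f≥0 (suc i) = begin
  f (suc i)                 ≡⟨ sym (+-identityˡ (f (suc i))) ⟩
  0ℚ + f (suc i)            ≤⟨ +-mono-≤ (f≥0 zero) (term≤sumFin (f≥0 ∘ suc) i) ⟩
  f zero + sumFin (f ∘ suc) ∎
  where open ≤-Reasoning

ReLU : ℚ → ℚ
ReLU = activate relu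

ReLU-nonneg : ∀ x → 0ℚ ≤ ReLU x
ReLU-nonneg = p≤p⊔q 0ℚ

ReLU-of-nonneg : ∀ {x} → 0ℚ ≤ x → ReLU x ≡ x
ReLU-of-nonneg = p≤q⇒p⊔q≡q

ReLU-of-nonpos : ∀ {x} → x ≤ 0ℚ → ReLU x ≡ 0ℚ
ReLU-of-nonpos = p≥q⇒p⊔q≡p

ReLU-pos : ∀ {x} → 0ℚ < x → 0ℚ < ReLU x
ReLU-pos x>0 = <-≤-trans x>0 (p≤q⊔p 0ℚ _)

unit : Fin p → ℚ → Vecℚ p
unit i s j = if does (i Fin.≟ j) then s else 0ℚ

unit-diag : (i : Fin p) (s : ℚ) → unit i s i ≡ s
unit-diag i s = cong (if_then s else 0ℚ) (dec-true (i Fin.≟ i) refl)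

unit-off : {i j : Fin p} (s : ℚ) → j ≢ i → unit i s j ≡ 0ℚ
unit-off {i = i} {j} s j≢i = cong (if_then s else 0ℚ) (dec-false (i Fin.≟ j) (j≢i ∘ sym))

sumFin-unit : (i : Fin p) (s : ℚ) (x : Vecℚ p) → sumFin (λ j → unit i s j * x j) ≡ s * x i
sumFin-unit i s x = trans (sumFin-single _ i off) (cong (_* x i) (unit-diag i s))
  where
  off : ∀ j → j ≢ i → unit i s j * x j ≡ 0ℚ
  off j j≢i = trans (cong (_* x j) (unit-off s j≢i)) (*-zeroˡ (x j))

applyFLayer-cong : (L : FLayer p q) → applyFLayer L Preserves _≗_ ⟶ _≗_
applyFLayer-cong L x≗y i = cong (λ s → activate (FLayer.act L) (s + FLayer.b L i))
                                (sumFin-cong (cong (FLayer.A L i _ *_) ∘ x≗y))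

runFNN-cong : (N : FNN p q) → runFNN N Preserves _≗_ ⟶ _≗_
runFNN-cong done    x≗y = x≗y
runFNN-cong (L ∷ N) x≗y = runFNN-cong N (applyFLayer-cong L x≗y)

≗-decSetoid : ℕ → DecSetoid 0ℓ 0ℓ
≗-decSetoid = Pointwise.decSetoid ≡-decSetoid

≗-setoid : ℕ → Setoid 0ℓ 0ℓ
≗-setoid p = DecSetoid.setoid (≗-decSetoid p)

open module ≗-Membership {p} = Membership (≗-setoid p) using (_∈_)

_≟ᵥ_ : (x y : Vecℚ p) → Dec (x ≗ y)
_≟ᵥ_ {p} = DecSetoid._≟_ (≗-decSetoid p)

-- Interpolation of finitely many points by a ReLU network

-- ∥x - y∥₁ = sumFin (gap x y), with |u| split as ReLU u + ReLU (- u) so that a single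
-- ReLU layer computes all summands
gap : Vecℚ p → Vecℚ p → Vecℚ (p ℕ.+ p)
gap x y = (λ c → ReLU (x c - y c)) ++ (λ c → ReLU (y c - x c))

dist : Vecℚ p → Vecℚ p → ℚ
dist x y = sumFin (gap x y)

gap-nonneg : (x y : Vecℚ p) → ∀ κ → 0ℚ ≤ gap x y κ
gap-nonneg {p} x y κ with splitAt p κ
... | inj₁ c = ReLU-nonneg (x c - y c)
... | inj₂ c = ReLU-nonneg (y c - x c)

gap-self : (x : Vecℚ p) → ∀ κ → gap x x κ ≡ 0ℚ
gap-self {p} x κ with splitAt p κ
... | inj₁ c = cong ReLU (+-inverseʳ (x c))
... | inj₂ c = cong ReLU (+-inverseʳ (x c))

dist-nonneg : (x y : Vecℚ p) → 0ℚ ≤ dist x y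
dist-nonneg x y = sumFin-nonneg (gap-nonneg x y)

dist-self : (x : Vecℚ p) → dist x x ≡ 0ℚ
dist-self x = sumFin-zero (gap-self x)

0<-difference : ∀ {x y} → x < y → 0ℚ < y - x
0<-difference {x} {y} x<y = begin-strict
  0ℚ     ≡⟨ sym (+-inverseʳ x) ⟩
  x - x  <⟨ +-monoˡ-< (- x) x<y ⟩
  y - x  ∎
  where open ≤-Reasoning

gap-pos : (x y : Vecℚ p) (c : Fin p) → x c ≢ y c → ∃ λ κ → 0ℚ < gap x y κ
gap-pos {p} x y c xc≢yc with <-cmp (x c) (y c)
... | tri≈ _ xc≡yc _ = contradiction xc≡yc xc≢yc
... | tri< xc<yc _ _ = p ↑ʳ c , subst (0ℚ <_) (sym (lookup-++ʳ (λ c → ReLU (x c - y c)) _ c))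
                                     (ReLU-pos (0<-difference xc<yc))
... | tri> _ _ xc>yc = c ↑ˡ p , subst (0ℚ <_) (sym (lookup-++ˡ _ (λ c → ReLU (y c - x c)) c))
                                     (ReLU-pos (0<-difference xc>yc))

dist-pos : (x y : Vecℚ p) → ¬ x ≗ y → 0ℚ < dist x y
dist-pos {p} x y x≉y =
  let c , xc≢yc = ¬∀⟶∃¬ p _ (λ c → x c ≟ y c) x≉y
      κ , gap>0 = gap-pos x y c xc≢yc
  in  <-≤-trans gap>0 (term≤sumFin (gap-nonneg x y) κ)

recip : ℚ → ℚ
recip d with d ≟ 0ℚ
... | yes _   = 0ℚ
... | no d≢0 = (1/ d) {{≢-nonZero d≢0}}

recip-nonneg : ∀ {d} → 0ℚ ≤ d → 0ℚ ≤ recip d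
recip-nonneg {d} d≥0 with d ≟ 0ℚ
... | yes _   = ≤-refl
... | no d≢0 = nonNegative⁻¹ 1/d {{pos⇒nonNeg 1/d {{1/pos⇒pos d {{d>0}}}}}}
  where
  1/d = (1/ d) {{≢-nonZero d≢0}}
  d>0 = nonNeg∧nonZero⇒pos d {{nonNegative d≥0}} {{≢-nonZero d≢0}}

recip-inverse : ∀ {d} → d ≢ 0ℚ → recip d * d ≡ 1ℚ
recip-inverse {d} d≢0 with d ≟ 0ℚ
... | yes d≡0  = contradiction d≡0 d≢0
... | no d≢0′ = *-inverseˡ d {{≢-nonZero d≢0′}}

signedUnit : Fin (p ℕ.+ p) → Vecℚ p
signedUnit = (λ c → unit c 1ℚ) ++ (λ c → unit c (- 1ℚ))

signedUnit-gap : (x y : Vecℚ p) → ∀ κ →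
                 ReLU (sumFin (λ c → signedUnit κ c * x c) + (V.map -_ y ++ y) κ) ≡ gap x y κ
signedUnit-gap {p} x y κ with splitAt p κ
... | inj₁ c = cong (λ s → ReLU (s - y c)) (trans (sumFin-unit c 1ℚ x) (*-identityˡ (x c)))
... | inj₂ c = cong ReLU (trans (cong (_+ y c) −x) (+-comm (- x c) (y c)))
  where
  −x : sumFin (λ c′ → unit c (- 1ℚ) c′ * x c′) ≡ - x c
  −x = trans (sumFin-unit c (- 1ℚ) x)
             (trans (sym (neg-distribˡ-* 1ℚ (x c))) (cong -_ (*-identityˡ (x c))))

-- hat x i = ReLU (1 - K i · dist x (t i)) is 1 at t i and vanishes at every other t j,
-- because K i ≥ 1 / dist (t j) (t i); the readout layer then sums y i · hat x i.
module Interpolation {p q m : ℕ} (t : Fin m → Vecℚ p)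
  (t-injective : ∀ {i j} → t i ≗ t j → i ≡ j) (y : Fin m → Vecℚ q) where

  K : Fin m → ℚ
  K i = sumFin (λ j → recip (dist (t j) (t i)))

  1≤K*dist : ∀ {i j} → j ≢ i → 1ℚ ≤ K i * dist (t j) (t i)
  1≤K*dist {i} {j} j≢i = begin
    1ℚ                          ≡⟨ sym (recip-inverse (≢-sym (<⇒≢ d>0))) ⟩
    recip d * d                 ≤⟨ *-monoʳ-≤-nonNeg d {{nonNegative (<⇒≤ d>0)}} recip≤K ⟩
    K i * d                     ∎
    where
    open ≤-Reasoning
    d = dist (t j) (t i)
    d>0 = dist-pos (t j) (t i) (j≢i ∘ t-injective)
    recip≤K = term≤sumFin (λ j → recip-nonneg (dist-nonneg (t j) (t i))) j

  cell : Fin (m ℕ.* (p ℕ.+ p)) → Fin m × Fin (p ℕ.+ p)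
  cell = remQuot (p ℕ.+ p)

  offset : Fin m × Fin (p ℕ.+ p) → ℚ
  offset (i , κ) = (V.map -_ (t i) ++ t i) κ

  differences : FLayer p (m ℕ.* (p ℕ.+ p))
  differences = record { A = signedUnit ∘ proj₂ ∘ cell ; b = offset ∘ cell ; act = relu }

  differences-combine : ∀ x i κ → applyFLayer differences x (combine i κ) ≡ gap x (t i) κ
  differences-combine x i κ =
    trans (cong (λ iκ → ReLU (sumFin (λ c → signedUnit (proj₂ iκ) c * x c) + offset iκ))
                (remQuot-combine {m} i κ))
          (signedUnit-gap x (t i) κ)

  hats : FLayer (m ℕ.* (p ℕ.+ p)) m
  hats = record { A = λ i → unit i (- K i) ∘ proj₁ ∘ cell ; b = λ _ → 1ℚ ; act = relu }

  hat : Vecℚ p → Vecℚ m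
  hat x = applyFLayer hats (applyFLayer differences x)

  hat-dist : ∀ x i → hat x i ≡ ReLU (- K i * dist x (t i) + 1ℚ)
  hat-dist x i = cong (λ s → ReLU (s + 1ℚ)) (begin
    sumFin (λ ρ → unit i (- K i) (proj₁ (cell ρ)) * h ρ)
      ≡⟨ sumFin-combine m (p ℕ.+ p) _ ⟩
    sumFin {m} (λ j → sumFin (λ κ → unit i (- K i) (proj₁ (cell (combine j κ)))
                                  * h (combine j κ)))
      ≡⟨ sumFin-cong (λ j → sumFin-cong (λ κ → cong₂ (λ j′ d → unit i (- K i) j′ * d)
                                                     (cong proj₁ (remQuot-combine {m} j κ))
                                                     (differences-combine x j κ))) ⟩
    sumFin (λ j → sumFin (λ κ → unit i (- K i) j * gap x (t j) κ))
      ≡⟨ sumFin-cong (λ j → sym (*-distribˡ-sumFin (unit i (- K i) j) (gap x (t j)))) ⟩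
    sumFin (λ j → unit i (- K i) j * dist x (t j))
      ≡⟨ sumFin-unit i (- K i) (λ j → dist x (t j)) ⟩
    - K i * dist x (t i) ∎)
    where
    open ≡-Reasoning
    h = applyFLayer differences x

  hat-centre : ∀ j → hat (t j) j ≡ 1ℚ
  hat-centre j = begin
    hat (t j) j                          ≡⟨ hat-dist (t j) j ⟩
    ReLU (- K j * dist (t j) (t j) + 1ℚ) ≡⟨ cong (λ d → ReLU (- K j * d + 1ℚ)) (dist-self (t j)) ⟩
    ReLU (- K j * 0ℚ + 1ℚ)               ≡⟨ cong (λ s → ReLU (s + 1ℚ)) (*-zeroʳ (- K j)) ⟩
    ReLU 1ℚ                              ≡⟨ ReLU-of-nonneg (nonNegative⁻¹ 1ℚ) ⟩
    1ℚ                                   ∎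
    where open ≡-Reasoning

  hat-off-centre : ∀ {i j} → i ≢ j → hat (t j) i ≡ 0ℚ
  hat-off-centre {i} {j} i≢j = trans (hat-dist (t j) i) (ReLU-of-nonpos (begin
    - K i * d + 1ℚ          ≡⟨ cong (_+ 1ℚ) (sym (neg-distribˡ-* (K i) d)) ⟩
    - (K i * d) + 1ℚ        ≤⟨ +-monoʳ-≤ (- (K i * d)) (1≤K*dist (i≢j ∘ sym)) ⟩
    - (K i * d) + K i * d   ≡⟨ +-inverseˡ (K i * d) ⟩
    0ℚ                      ∎))
    where
    open ≤-Reasoning
    d = dist (t j) (t i)

  readout : FLayer m q
  readout = record { A = λ c i → y i c ; b = λ _ → 0ℚ ; act = ident }

  network : FNN p q
  network = differences ∷ hats ∷ readout ∷ done

  network-correct : ∀ j → runFNN network (t j) ≗ y j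
  network-correct j c = begin
    sumFin (λ i → y i c * hat (t j) i) + 0ℚ ≡⟨ +-identityʳ _ ⟩
    sumFin (λ i → y i c * hat (t j) i)      ≡⟨ sumFin-single _ j off-centre ⟩
    y j c * hat (t j) j                     ≡⟨ cong (y j c *_) (hat-centre j) ⟩
    y j c * 1ℚ                              ≡⟨ *-identityʳ (y j c) ⟩
    y j c                                   ∎
    where
    open ≡-Reasoning
    off-centre : ∀ i → i ≢ j → y i c * hat (t j) i ≡ 0ℚ
    off-centre i i≢j = trans (cong (y i c *_) (hat-off-centre i≢j)) (*-zeroʳ (y i c))

lookup-injective : ∀ {c ℓ} (S : Setoid c ℓ) {xs} → Unique.Unique S xs →
                   ∀ {i j} → Setoid._≈_ S (lookup xs i) (lookup xs j) → i ≡ j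
lookup-injective S (_    ∷ _)  {zero}  {zero}  _  = refl
lookup-injective S (x≉xs ∷ _)  {zero}  {suc j} eq =
  contradiction eq (All.lookup x≉xs (Propositional.∈-lookup j))
lookup-injective S (x≉xs ∷ _)  {suc i} {zero}  eq =
  contradiction (Setoid.sym S eq) (All.lookup x≉xs (Propositional.∈-lookup i))
lookup-injective S (_    ∷ !xs) {suc i} {suc j} eq = cong suc (lookup-injective S !xs eq)

module Deduplicated {p} (P : List (Vecℚ p)) where

  points : List (Vecℚ p)
  points = deduplicate _≟ᵥ_ P

  point : Fin (length points) → Vecℚ p
  point = lookup points

  point-injective : ∀ {i j} → point i ≗ point j → i ≡ j
  point-injective = lookup-injective (≗-setoid p) (deduplicate-! (≗-decSetoid p) P)

  ∈-points : ∀ {x} → x ∈ P → x ∈ points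
  ∈-points = ∈-deduplicate⁺ (≗-setoid p) _≟ᵥ_ λ z≗y x≗y i → trans (x≗y i) (sym (z≗y i))

interpolate : List (Vecℚ p) → (Vecℚ p → Vecℚ q) → FNN p q
interpolate P F = Interpolation.network point point-injective (F ∘ point)
  where open Deduplicated P

interpolate-correct : (P : List (Vecℚ p)) (F : Vecℚ p → Vecℚ q) → F Preserves _≗_ ⟶ _≗_ →
                      ∀ {x} → x ∈ P → runFNN (interpolate P F) x ≗ F x
interpolate-correct P F F-cong {x} x∈P c = begin
  runFNN (interpolate P F) x c         ≡⟨ runFNN-cong (interpolate P F) x≗point c ⟩
  runFNN (interpolate P F) (point j) c ≡⟨ network-correct j c ⟩
  F (point j) c                        ≡⟨ F-cong x≗point c ⟨
  F x c                                ∎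
  where
  open ≡-Reasoning
  open Deduplicated P
  open Interpolation point point-injective (F ∘ point)
  j = index (∈-points x∈P)
  x≗point = lookup-index (∈-points x∈P)

vectorsOver : ∀ {a} {A : Set a} → List A → ∀ k → List (Vector A k)
vectorsOver xs zero    = [ V.[] ]
vectorsOver xs (suc k) = cartesianProductWith V._∷_ xs (vectorsOver xs k)

listsUpTo : ∀ {a} {A : Set a} → ℕ → List A → List (List A)
listsUpTo zero    xs = [ [] ]
listsUpTo (suc n) xs = [] ∷ cartesianProductWith _∷_ xs (listsUpTo n xs)

module _ {c ℓ} (S : Setoid c ℓ) where

  open Setoid S using (Carrier; _≈_)
  open Membership S using () renaming (_∈_ to _∈ₛ_)
  open Equality S using (≋-setoid)
  open Membership ≋-setoid using () renaming (_∈_ to _∈ₗ_)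
  open module Vectors {k} = Membership (Pointwise.setoid S k) using () renaming (_∈_ to _∈ᵥₛ_)

  ∈-vectorsOver : ∀ {xs} k {v : Vector Carrier k} →
                  (∀ i → v i ∈ₛ xs) → v ∈ᵥₛ vectorsOver xs k
  ∈-vectorsOver zero    v∈ = here (λ ())
  ∈-vectorsOver (suc k) {v} v∈ = ∈-resp-≈ (Pointwise.setoid S (suc k)) head∷tail
    (∈-cartesianProductWith⁺ S (Pointwise.setoid S k) (Pointwise.setoid S (suc k))
      ∷-cong (v∈ zero) (∈-vectorsOver k (v∈ ∘ suc)))
    where
    head∷tail : Pointwise _≈_ (v zero V.∷ v ∘ suc) v
    head∷tail zero    = Setoid.refl S
    head∷tail (suc i) = Setoid.refl S

    ∷-cong : ∀ {x y} {u w : Vector Carrier k} →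
             x ≈ y → Pointwise _≈_ u w → Pointwise _≈_ (x V.∷ u) (y V.∷ w)
    ∷-cong x≈y u≈w zero    = x≈y
    ∷-cong x≈y u≈w (suc i) = u≈w i

  ∈-listsUpTo : ∀ n {xs ys} → length ys ℕ.≤ n → All (_∈ₛ xs) ys → ys ∈ₗ listsUpTo n xs
  ∈-listsUpTo zero    {ys = []}     _          []            = here []
  ∈-listsUpTo (suc n) {ys = []}     _          []            = here []
  ∈-listsUpTo (suc n) {ys = y ∷ ys} (ℕ.s≤s ≤n) (y∈xs ∷ ys∈) =
    there (∈-cartesianProductWith⁺ S ≋-setoid ≋-setoid _∷_ y∈xs (∈-listsUpTo n ≤n ys∈))

column : ∀ {r} → Fin r → List (Vecℚ r) → List ℚ
column i = map (λ x → x i)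

aggregate-column : ∀ {r s} ag {xs : List (Vecℚ r)} {ys : List (Vecℚ s)} {i k} →
                   column i xs ≡ column k ys → aggregate ag xs i ≡ aggregate ag ys k
aggregate-column SUM  eq = cong sumList eq
aggregate-column MEAN eq = cong meanList eq
aggregate-column MAX  eq = cong maxList eq

column-map : ∀ {W : Set} {r s} (g : W → Vecℚ r) (h : W → Vecℚ s) {i k} →
             (∀ w → g w i ≡ h w k) → ∀ ws → column i (map g ws) ≡ column k (map h ws)
column-map g h e []       = refl
column-map g h e (w ∷ ws) = cong₂ _∷_ (e w) (column-map g h e ws)

column-cong : ∀ {r} {xs ys : List (Vecℚ r)} →
              ListPointwise _≗_ xs ys → ∀ i → column i xs ≡ column i ys
column-cong []             i = refl
column-cong (x≗y ∷ xs≗ys) i = cong₂ _∷_ (x≗y i) (column-cong xs≗ys i)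

aggregate-cong : ∀ {r} ag {xs ys : List (Vecℚ r)} →
                 ListPointwise _≗_ xs ys → aggregate ag xs ≗ aggregate ag ys
aggregate-cong ag xs≗ys i = aggregate-column ag (column-cong xs≗ys i)

length-neighbours : ∀ {ℓ n} (G : LGraph ℓ n) v → length (neighbours G v) ℕ.≤ n
length-neighbours {n = n} G v =
  ℕ.≤-trans (length-filter (T? ∘ adj G v) (allFin n)) (ℕ.≤-reflexive (length-tabulate id))

applyGNN1Layer-cong : ∀ {ℓ n} (L : GNN1Layer p q) (G : LGraph ℓ n) {f g : Signal n p} →
                      Pointwise _≗_ f g → Pointwise _≗_ (applyGNN1Layer L G f) (applyGNN1Layer L G g)
applyGNN1Layer-cong L G f≗g v = runFNN-cong comb (++-cong _ _ (f≗g v) λ i →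
  aggregate-column agg (column-map _ _ (λ w → runFNN-cong msg (f≗g w) i) (neighbours G v)))
  where open GNN1Layer L

applyGNN2Layer-cong : ∀ {ℓ n} (L : GNN2Layer p q) (G : LGraph ℓ n) {f g : Signal n p} →
                      Pointwise _≗_ f g → Pointwise _≗_ (applyGNN2Layer L G f) (applyGNN2Layer L G g)
applyGNN2Layer-cong L G f≗g v = runFNN-cong comb (++-cong _ _ (f≗g v) λ i →
  aggregate-column agg (column-map _ _ (λ w → runFNN-cong msg (++-cong _ _ (f≗g v) (f≗g w)) i)
                                   (neighbours G v)))
  where open GNN2Layer L

runGNN1-cong : ∀ {ℓ n} (N : GNN1 p q) (G : LGraph ℓ n) {f g : Signal n p} →
               Pointwise _≗_ f g → Pointwise _≗_ (runGNN1 N G f) (runGNN1 N G g)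
runGNN1-cong done    G f≗g = f≗g
runGNN1-cong (L ∷ N) G f≗g = runGNN1-cong N G (applyGNN1Layer-cong L G f≗g)

runGNN2-cong : ∀ {ℓ n} (N : GNN2 p q) (G : LGraph ℓ n) {f g : Signal n p} →
               Pointwise _≗_ f g → Pointwise _≗_ (runGNN2 N G f) (runGNN2 N G g)
runGNN2-cong done    G f≗g = f≗g
runGNN2-cong (L ∷ N) G f≗g = runGNN2-cong N G (applyGNN2Layer-cong L G f≗g)

-- From 1-GNNs to 2-GNNs

secondHalf : ∀ p → FLayer (p ℕ.+ p) p
secondHalf p = record { A = λ i → unit (p ↑ʳ i) 1ℚ ; b = λ _ → 0ℚ ; act = ident }

secondHalf-++ : (x y : Vecℚ p) → applyFLayer (secondHalf p) (x ++ y) ≗ y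
secondHalf-++ {p} x y i = begin
  sumFin (λ j → unit (p ↑ʳ i) 1ℚ j * (x ++ y) j) + 0ℚ ≡⟨ +-identityʳ _ ⟩
  sumFin (λ j → unit (p ↑ʳ i) 1ℚ j * (x ++ y) j)      ≡⟨ sumFin-unit (p ↑ʳ i) 1ℚ _ ⟩
  1ℚ * (x ++ y) (p ↑ʳ i)                              ≡⟨ *-identityˡ _ ⟩
  (x ++ y) (p ↑ʳ i)                                   ≡⟨ lookup-++ʳ x y i ⟩
  y i                                                 ∎
  where open ≡-Reasoning

embedLayer : GNN1Layer p q → GNN2Layer p q
embedLayer {p} L = record { r = r ; msg = secondHalf p ∷ msg ; agg = agg ; comb = comb }
  where open GNN1Layer L

embed : GNN1 p q → GNN2 p q
embed done    = done
embed (L ∷ N) = embedLayer L ∷ embed N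

applyGNN2Layer-embedLayer : ∀ {ℓ n} (L : GNN1Layer p q) (G : LGraph ℓ n) (f : Signal n p) →
                            Pointwise _≗_ (applyGNN2Layer (embedLayer L) G f) (applyGNN1Layer L G f)
applyGNN2Layer-embedLayer L G f v = runFNN-cong comb (++-cong _ _ (λ _ → refl) λ i →
  aggregate-column agg (column-map _ _ (λ w → runFNN-cong msg (secondHalf-++ (f v) (f w)) i)
                                   (neighbours G v)))
  where open GNN1Layer L

runGNN2-embed : ∀ {ℓ n} (N : GNN1 p q) (G : LGraph ℓ n) (f : Signal n p) →
                Pointwise _≗_ (runGNN2 (embed N) G f) (runGNN1 N G f)
runGNN2-embed done    G f v i = refl
runGNN2-embed (L ∷ N) G f v i = trans (runGNN2-embed N G _ v i)
                                      (runGNN1-cong N G (applyGNN2Layer-embedLayer L G f) v i)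



-- From 2-GNNs to 1-GNNs on graphs of a fixed order

module Simulation {p q} (n : ℕ) (S : List (Vecℚ p)) (L : GNN2Layer p q) where

  open GNN2Layer L
  open Deduplicated S

  m : ℕ
  m = length points

  block : Fin m → Vecℚ (m ℕ.* r) → Vecℚ r
  block j z c = z (combine j c)

  -- block j of the table is the message L sends to a receiver whose feature is point j
  messageTable : Vecℚ p → Vecℚ (m ℕ.* r)
  messageTable y ρ = runFNN msg (point (proj₁ jc) ++ y) (proj₂ jc)
    where jc = remQuot {m} r ρ

  block-messageTable : ∀ j y → block j (messageTable y) ≗ runFNN msg (point j ++ y)
  block-messageTable j y c =
    cong (λ jc → runFNN msg (point (proj₁ jc) ++ y) (proj₂ jc)) (remQuot-combine j c)

  messageTable-cong : messageTable Preserves _≗_ ⟶ _≗_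
  messageTable-cong y≗y′ ρ = runFNN-cong msg (++-cong _ _ (λ _ → refl) y≗y′) _

  message : FNN p (m ℕ.* r)
  message = interpolate S messageTable

  combineOwnBlock : Vecℚ (p ℕ.+ m ℕ.* r) → Vecℚ q
  combineOwnBlock u with any? (take p u ≟ᵥ_) points
  ... | yes own∈ = runFNN comb (take p u ++ block (index own∈) (drop p u))
  ... | no _     = λ _ → 0ℚ   -- never reached from a graph whose features lie in S

  combineOwnBlock-at : ∀ {u} j → take p u ≗ point j →
                       combineOwnBlock u ≗ runFNN comb (take p u ++ block j (drop p u))
  combineOwnBlock-at {u} j own≗ with any? (take p u ≟ᵥ_) points
  ... | yes own∈ rewrite point-injective (λ i → trans (sym (lookup-index own∈ i)) (own≗ i)) =
    λ _ → refl
  ... | no own∉  =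
    contradiction (∈-resp-≈ (≗-setoid p) (sym ∘ own≗) (∈-lookup (≗-setoid p) points j)) own∉

  combineOwnBlock-cong : combineOwnBlock Preserves _≗_ ⟶ _≗_
  combineOwnBlock-cong {u} {u′} u≗u′ with any? (take p u ≟ᵥ_) points
  ... | yes own∈ = λ c → trans (runFNN-cong comb (++-cong _ _ own≗ (u≗u′ ∘ (p ↑ʳ_) ∘ combine j)) c)
                               (sym (combineOwnBlock-at j own′≗ c))
    where
    j = index own∈
    own≗ = u≗u′ ∘ (_↑ˡ m ℕ.* r)
    own′≗ = λ i → trans (sym (own≗ i)) (lookup-index own∈ i)
  ... | no own∉ with any? (take p u′ ≟ᵥ_) points
  ...   | yes own′∈ = contradiction (∈-resp-≈ (≗-setoid p) (sym ∘ u≗u′ ∘ (_↑ˡ m ℕ.* r)) own′∈) own∉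
  ...   | no _      = λ _ → refl

  withAggregate : Vecℚ p → List (Vecℚ p) → Vecℚ (p ℕ.+ m ℕ.* r)
  withAggregate x ys = x ++ aggregate agg (map (runFNN message) ys)

  withAggregate-cong : ∀ {x x′ ys ys′} → x ≗ x′ → ListPointwise _≗_ ys ys′ →
                       withAggregate x ys ≗ withAggregate x′ ys′
  withAggregate-cong x≗x′ ys≗ys′ = ++-cong _ _ x≗x′ (aggregate-cong agg
    (ListPointwise.map⁺ _ _ (ListPointwise.map (runFNN-cong message) ys≗ys′)))

  inputs : List (Vecℚ (p ℕ.+ m ℕ.* r))
  inputs = cartesianProductWith withAggregate S (listsUpTo n S)

  layer : GNN1Layer p q
  layer = record { r = m ℕ.* r ; msg = message ; agg = agg ; comb = interpolate inputs combineOwnBlock }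

  outputs : List (Vecℚ q)
  outputs = map combineOwnBlock inputs

  module _ {ℓ} (G : LGraph ℓ n) (f : Signal n p) (f∈S : ∀ v → f v ∈ S) where

    open Membership (Equality.≋-setoid (≗-setoid p)) using () renaming (_∈_ to _∈ₗ_)

    input : Fin n → Vecℚ (p ℕ.+ m ℕ.* r)
    input v = f v ++ aggregate agg (map (λ w → runFNN message (f w)) (neighbours G v))

    neighbourFeatures∈ : ∀ v → map f (neighbours G v) ∈ₗ listsUpTo n S
    neighbourFeatures∈ v = ∈-listsUpTo (≗-setoid p) n
      (ℕ.≤-trans (ℕ.≤-reflexive (length-map f (neighbours G v))) (length-neighbours G v))
      (All.map⁺ (All.universal f∈S (neighbours G v)))

    input∈inputs : ∀ v → input v ∈ inputs
    input∈inputs v =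
      subst (_∈ inputs) (cong (λ ms → f v ++ aggregate agg ms) (sym (map-∘ (neighbours G v))))
        (∈-cartesianProductWith⁺ (≗-setoid p) (Equality.≋-setoid (≗-setoid p)) (≗-setoid _)
                                 withAggregate-cong (f∈S v) (neighbourFeatures∈ v))

    combineOwnBlock-input : ∀ v → combineOwnBlock (input v) ≗ applyGNN2Layer L G f v
    combineOwnBlock-input v c =
      trans (combineOwnBlock-at j (λ i → trans (lookup-++ˡ (f v) _ i) (own≗ i)) c)
            (runFNN-cong comb (++-cong _ _ (lookup-++ˡ (f v) _) received) c)
      where
      j = index (∈-points (f∈S v))
      own≗ = lookup-index (∈-points (f∈S v))

      message-block : ∀ c w → runFNN message (f w) (combine j c) ≡ runFNN msg (f v ++ f w) c
      message-block c w = begin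
        runFNN message (f w) (combine j c)
          ≡⟨ interpolate-correct S messageTable messageTable-cong (f∈S w) (combine j c) ⟩
        messageTable (f w) (combine j c)
          ≡⟨ block-messageTable j (f w) c ⟩
        runFNN msg (point j ++ f w) c
          ≡⟨ runFNN-cong msg (++-cong _ _ own≗ (λ _ → refl)) c ⟨
        runFNN msg (f v ++ f w) c ∎
        where open ≡-Reasoning

      received : block j (drop p (input v)) ≗
                 aggregate agg (map (λ w → runFNN msg (f v ++ f w)) (neighbours G v))
      received c = trans (lookup-++ʳ (f v) _ (combine j c))
                         (aggregate-column agg (column-map _ _ (message-block c) (neighbours G v)))

    layer-input : ∀ v → applyGNN1Layer layer G f v ≗ combineOwnBlock (input v)
    layer-input v = interpolate-correct inputs combineOwnBlock combineOwnBlock-cong (input∈inputs v)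

    layer-simulates : Pointwise _≗_ (applyGNN1Layer layer G f) (applyGNN2Layer L G f)
    layer-simulates v c = trans (layer-input v c) (combineOwnBlock-input v c)

    layer∈outputs : ∀ v → applyGNN1Layer layer G f v ∈ outputs
    layer∈outputs v = ∈-resp-≈ (≗-setoid q) (sym ∘ layer-input v)
      (∈-map⁺ (≗-setoid _) (≗-setoid q) combineOwnBlock-cong (input∈inputs v))

simulate : ℕ → List (Vecℚ p) → GNN2 p q → GNN1 p q
simulate n S done    = done
simulate n S (L ∷ N) = Simulation.layer n S L ∷ simulate n (Simulation.outputs n S L) N

runGNN1-simulate : ∀ {ℓ n} (N : GNN2 p q) (S : List (Vecℚ p)) (G : LGraph ℓ n) (f : Signal n p) →
                   (∀ v → f v ∈ S) → Pointwise _≗_ (runGNN1 (simulate n S N) G f) (runGNN2 N G f)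
runGNN1-simulate done    S G f f∈S v c = refl
runGNN1-simulate (L ∷ N) S G f f∈S v c =
  trans (runGNN1-simulate N _ G _ (Simulation.layer∈outputs _ S L G f f∈S) v c)
        (runGNN2-cong N G (Simulation.layer-simulates _ S L G f f∈S) v c)

Computes-cong : ∀ {ℓ} (𝒬 : Query ℓ) (out out′ : ∀ {n} → ℕ → LGraph ℓ n → Fin n → ℚ) →
                (∀ {n} (G : LGraph ℓ n) v → out n G v ≡ out′ n G v) →
                Computes 𝒬 out → Computes 𝒬 out′
Computes-cong 𝒬 out out′ out≡ computes n n≥1 G v =
  let accept , reject = computes n n≥1 G v
  in  subst (threeQuarters ≤_) (out≡ G v) ∘ accept , subst (_≤ oneQuarter) (out≡ G v) ∘ reject

booleanVectors : ∀ ℓ → List (Vecℚ ℓ)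
booleanVectors = vectorsOver (0ℚ ∷ 1ℚ ∷ [])

boolSignal∈booleanVectors : ∀ {ℓ n} (G : LGraph ℓ n) v → boolSignal G v ∈ booleanVectors ℓ
boolSignal∈booleanVectors {ℓ} G v = ∈-vectorsOver (setoid ℚ) ℓ (bit∈ ∘ labels G v)
  where
  bit∈ : ∀ b → Any ((if b then 1ℚ else 0ℚ) ≡_) (0ℚ ∷ 1ℚ ∷ [])
  bit∈ false = here refl
  bit∈ true  = there (here refl)

corollary4p4 : (ℓ : ℕ) (𝒬 : Query ℓ) →
    ComputedByGNN1Family 𝒬 ⇔ ComputedByGNN2Family 𝒬
corollary4p4 ℓ 𝒬 = mk⇔ GNN1⇒GNN2 GNN2⇒GNN1
  where
  GNN1⇒GNN2 : ComputedByGNN1Family 𝒬 → ComputedByGNN2Family 𝒬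
  GNN1⇒GNN2 (𝔑 , computes) = embed ∘ 𝔑 ,
    Computes-cong 𝒬 (λ k G v → runGNN1 (𝔑 k) G (boolSignal G) v zero)
                    (λ k G v → runGNN2 (embed (𝔑 k)) G (boolSignal G) v zero)
                    (λ {n} G v → sym (runGNN2-embed (𝔑 n) G (boolSignal G) v zero))
                    computes

  GNN2⇒GNN1 : ComputedByGNN2Family 𝒬 → ComputedByGNN1Family 𝒬
  GNN2⇒GNN1 (𝔑 , computes) = simulated ,
    Computes-cong 𝒬 (λ k G v → runGNN2 (𝔑 k) G (boolSignal G) v zero)
                    (λ k G v → runGNN1 (simulated k) G (boolSignal G) v zero)
                    (λ {n} G v → sym (runGNN1-simulate (𝔑 n) _ G (boolSignal G)
                                                       (boolSignal∈booleanVectors G) v zero))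
                    computes
    where
    simulated : ℕ → GNN1 ℓ 1
    simulated n = simulate n (booleanVectors ℓ) (𝔑 n)
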